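{- Let $G=(V,E)$ be a word-representable graph with $n=|V|$ and representation number $k$. Unless $G$ is a circle graph containing $K_{n-1}$ as an induced subgraph, $G$ is $\left(\left\lceil\frac{kn}{2}\right\rceil-1\right)$-complete square-free uniform word-representable.
   Context: A circle graph is the intersection graph of a finite set of chords of a circle. For a word $w$ and a set $S$ of letters, $w_S$ is the word obtained from $w$ by deleting all letters not in $S$. Two distinct letters $x,y$ alternate in $w$ if $w_{\{x,y\}}$ is of the form $xyxy\cdots$ or $yxyx\cdots$ (even or odd length). A simple graph $G=(V,E)$ is word-representable if there is a word $w$ over $V$, containing every vertex, such that distinct $x,y$ alternate in $w$ iff $xy\in E$. A word is $k$-uniform (uniform) if every letter occurs exactly $k$ times; the representation number of a word-representable graph is the least $k$ such that some $k$-uniform word represents it. A square is a factor (block of consecutive letters) $XX$ with $X$ non-empty. A word $w$ contains a $p$-complete square if there is a set $S$ of letters such that $w_S$ contains a square $XX$ with $|X|\ge p$; otherwise $w$ is $p$-complete square-free. A graph $G$ is $p$-complete square-free uniform word-representable if it is represented by a uniform word $w$ that is $p$-complete square-free, where $1\le p\le\lceil|w|/2\rceil$. -}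

module Defs where

open import Data.Nat using (ℕ; zero; suc; _+_; _*_; _∸_; _≤_; _<_; ⌈_/2⌉)
open import Data.Fin using (Fin; _≟_)
open import Data.Bool using (Bool; true; false; _∨_; if_then_else_)
open import Data.List using (List; []; _∷_; _++_; length)
open import Data.List.Membership.Propositional using (_∈_)
open import Data.Product using (Σ; ∃; ∃-syntax; _×_; _,_)
open import Data.Sum using (_⊎_)
open import Relation.Nullary using (¬_)
open import Relation.Nullary.Decidable using (isYes)
open import Relation.Binary.PropositionalEquality using (_≡_; _≢_)
open import Function.Bundles using (_⇔_)

record SimpleGraph (n : ℕ) : Set₁ where
  field
    Adj   : Fin n → Fin n → Set
    sym   : ∀ {x y} → Adj x y → Adj y x
    irrefl : ∀ {x} → ¬ Adj x x

Word : ℕ → Set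
Word n = List (Fin n)

restrict : ∀ {n} → (Fin n → Bool) → Word n → Word n
restrict S [] = []
restrict S (z ∷ w) = if S z then z ∷ restrict S w else restrict S w

altWord : ∀ {n} → Fin n → Fin n → ℕ → Word n
altWord x y zero = []
altWord x y (suc m) = x ∷ altWord y x m

pairSet : ∀ {n} → Fin n → Fin n → Fin n → Bool
pairSet x y z = isYes (z ≟ x) ∨ isYes (z ≟ y)

Alternate : ∀ {n} → Word n → Fin n → Fin n → Set
Alternate w x y =
  ∃[ m ] (restrict (pairSet x y) w ≡ altWord x y m ⊎ restrict (pairSet x y) w ≡ altWord y x m)

Represents : ∀ {n} → SimpleGraph n → Word n → Set
Represents {n} G w =
  (∀ (v : Fin n) → v ∈ w) ×
  (∀ (x y : Fin n) → x ≢ y → (Alternate w x y ⇔ SimpleGraph.Adj G x y))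

WordRepresentable : ∀ {n} → SimpleGraph n → Set
WordRepresentable {n} G = Σ (Word n) λ w → Represents G w

occ : ∀ {n} → Fin n → Word n → ℕ
occ v w = length (restrict (λ z → isYes (z ≟ v)) w)

Uniform : ∀ {n} → ℕ → Word n → Set
Uniform {n} k w = ∀ (v : Fin n) → occ v w ≡ k

RepresentationNumber : ∀ {n} → SimpleGraph n → ℕ → Set
RepresentationNumber G k =
  (∃[ w ] (Uniform k w × Represents G w)) ×
  (∀ k′ → k′ < k → ∀ w → Uniform k′ w → ¬ Represents G w)

HasSquareFactor : ∀ {n} → ℕ → Word n → Set
HasSquareFactor p u = ∃[ a ] ∃[ X ] ∃[ b ] (u ≡ a ++ X ++ X ++ b × p ≤ length X × 1 ≤ length X)

ContainsCompleteSquare : ∀ {n} → ℕ → Word n → Set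
ContainsCompleteSquare {n} p w = Σ (Fin n → Bool) λ S → HasSquareFactor {n} p (restrict S w)

CSFUniformWordRepresentable : ∀ {n} → SimpleGraph n → ℕ → Set
CSFUniformWordRepresentable G p =
  ∃[ w ] ((∃[ k ] Uniform k w) × Represents G w × ¬ ContainsCompleteSquare p w
           × 1 ≤ p × p ≤ ⌈ length w /2⌉)

-- A chord of the circle is given by its two endpoints,
-- encoded as positions a < b in the cyclic order of points on the circle
-- (intersection of chords depends only on the cyclic order of endpoints).
Chord : Set
Chord = ℕ × ℕ

ValidChord : Chord → Set
ValidChord (a , b) = a < b

ChordsIntersect : Chord → Chord → Set
ChordsIntersect (a , b) (c , d) =
  a ≡ c ⊎ a ≡ d ⊎ b ≡ c ⊎ b ≡ d ⊎
  (a < c × c < b × b < d) ⊎ (c < a × a < d × d < b)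

CircleGraph : ∀ {n} → SimpleGraph n → Set
CircleGraph {n} G =
  Σ (Fin n → Chord) λ ch → ((∀ (v : Fin n) → ValidChord (ch v)) ×
           (∀ (u v : Fin n) → u ≢ v → ch u ≢ ch v) ×
           (∀ (u v : Fin n) → u ≢ v → (SimpleGraph.Adj G u v ⇔ ChordsIntersect (ch u) (ch v))))

ContainsClique : ∀ {n} → SimpleGraph n → ℕ → Set
ContainsClique {n} G m =
  Σ (Fin m → Fin n) λ f → ((∀ (i j : Fin m) → f i ≡ f j → i ≡ j) ×
          (∀ (i j : Fin m) → i ≢ j → SimpleGraph.Adj G (f i) (f j)))

{-# OPTIONS --safe #-}
module Submission where

-- Let w be a k-uniform representant of G with k minimal, and suppose some restriction w_S contains a
-- square XX with |X| ≥ ⌈kn/2⌉ − 1.  Every letter occurs at most k/2 times in X, so for odd k this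
-- forces n ≤ 2, while for k = 2h every letter occurs exactly h times in X except at most one letter c
-- occurring h − 1 times.  A letter occurring h times in X occurs nowhere else in w, so for two such
-- letters w_{x,y} is the square of X_{x,y}; since their counts agree, x and y alternate in w iff they
-- alternate in X.  If no letter is short, X is an h-uniform representant of G.  If c is short and
-- h ≥ 2, then c alternates with no letter (the square of an alternating word is balanced), so X with
-- c erased and c^h appended is an h-uniform representant.  Both contradict minimality.  If h = 1,
-- the other letters occur once in X and hence pairwise alternate, so G − c is complete, and a graph
-- that is complete away from one vertex is a circle graph containing K_{n−1}, as is every graph with
-- at most two vertices.

open import Defs
open import Data.Nat using (ℕ; zero; suc; _+_; _*_; _∸_; _≤_; _<_; z≤n; s≤s; z<s; s<s; ⌈_/2⌉; _≤?_)
import Data.Nat as ℕ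
open import Data.Nat.Properties
  using ( suc-injective; ≤-reflexive; ≤-trans; ≤-antisym; ≤-pred; <-irrefl; <⇒≢; <⇒≱; ≰⇒>; ≤∧≢⇒<
        ; n≤1+n; m≤m+n; m<m+n; m≤n+m∸n; m∸n≤m; m≢1+m+n; m+n≡0⇒m≡0; m+n≡0⇒n≡0
        ; +-mono-≤; +-monoˡ-≤; +-monoʳ-≤; +-cancelˡ-≤; +-cancelʳ-≤; +-cancelˡ-≡; +-suc; +-identityʳ
        ; *-suc; *-zeroʳ; *-distribʳ-+; *-monoˡ-≤; *-identityˡ; ∸-monoˡ-≤
        ; ⌈n/2⌉-mono; ⌊n/2⌋+⌈n/2⌉≡n; ⌊n/2⌋≤⌈n/2⌉; +-0-commutativeMonoid; 1+n≢n; 1+n≰n; module ≤-Reasoning )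
open import Data.Nat.Tactic.RingSolver using (solve-∀)
open import Data.Fin using (Fin; _≟_; toℕ; fromℕ<; punchIn; punchOut) renaming (zero to fzero; suc to fsuc)
open import Data.Fin.Properties
  using (toℕ<n; toℕ-injective; punchIn-injective; punchInᵢ≢i; punchIn-punchOut; all?; ¬∀⟶∃¬)
open import Data.Vec.Functional using (removeAt)
open import Algebra.Properties.CommutativeMonoid.Sum +-0-commutativeMonoid using (sum; sum-cong-≗; sum-remove)
open import Data.Bool using (Bool; true; false; _∨_; not)
open import Data.Bool.Properties using (∨-comm)
open import Data.List using ([]; _∷_; _++_; length; replicate)
open import Data.List.Properties using (length-++; ++-assoc; ++-identityʳ; ≡-dec; ∷-injectiveˡ; ∷-injectiveʳ)
open import Data.List.Membership.Propositional using (_∈_)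
open import Data.List.Relation.Unary.Any using (here; there)
open import Data.List.Relation.Unary.All as All using (All; []; _∷_)
open import Data.Product using (∃-syntax; _×_; _,_; proj₁; proj₂; map₂)
open import Data.Sum using (_⊎_; inj₁; inj₂; swap)
open import Data.Empty using (⊥; ⊥-elim)
open import Function using (_∘_)
open import Function.Bundles using (_⇔_; mk⇔; Equivalence)
open import Function.Properties.Equivalence using () renaming (sym to ⇔-sym; trans to ⇔-trans)
open import Relation.Nullary using (¬_; Dec; yes; no; contradiction)
open import Relation.Nullary.Decidable using (isYes) renaming (map to map-Dec)
open import Relation.Binary using (Decidable)
open import Relation.Binary.PropositionalEquality

private variable
  n : ℕ
  x y z c v : Fin n
  S T : Fin n → Bool
  u w R A B : Word n

_⊆ᵇ_ : (S T : Fin n → Bool) → Set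
S ⊆ᵇ T = ∀ z → S z ≡ true → T z ≡ true

restrict-++ : ∀ (S : Fin n → Bool) A B → restrict S (A ++ B) ≡ restrict S A ++ restrict S B
restrict-++ S []      B = refl
restrict-++ S (z ∷ A) B with S z
... | true  = cong (z ∷_) (restrict-++ S A B)
... | false = restrict-++ S A B

restrict-cong : S ≗ T → ∀ u → restrict S u ≡ restrict T u
restrict-cong S≗T []      = refl
restrict-cong {S = S} {T} S≗T (z ∷ u) rewrite S≗T z with T z
... | true  = cong (z ∷_) (restrict-cong S≗T u)
... | false = restrict-cong S≗T u

restrict-⊆ : T ⊆ᵇ S → ∀ u → restrict T (restrict S u) ≡ restrict T u
restrict-⊆ T⊆S [] = refl
restrict-⊆ {T = T} {S} T⊆S (z ∷ u) with S z in Sz | T z in Tz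
... | true  | true  rewrite Tz = cong (z ∷_) (restrict-⊆ T⊆S u)
... | true  | false rewrite Tz = restrict-⊆ T⊆S u
... | false | true  = contradiction (trans (sym Sz) (T⊆S z Tz)) λ ()
... | false | false = restrict-⊆ T⊆S u

restrict-disjoint : (∀ z → T z ≡ true → S z ≡ false) → ∀ u → restrict T (restrict S u) ≡ []
restrict-disjoint T∩S [] = refl
restrict-disjoint {T = T} {S} T∩S (z ∷ u) with S z in Sz | T z in Tz
... | true  | true  = contradiction (trans (sym Sz) (T∩S z Tz)) λ ()
... | true  | false rewrite Tz = restrict-disjoint T∩S u
... | false | _     = restrict-disjoint T∩S u

restrict-replicate : S c ≡ true → ∀ h → restrict S (replicate h c) ≡ replicate h c
restrict-replicate Sc zero    = refl
restrict-replicate {c = c} Sc (suc h) rewrite Sc = cong (c ∷_) (restrict-replicate Sc h)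

restrict-All : ∀ (S : Fin n → Bool) u → All (λ z → S z ≡ true) (restrict S u)
restrict-All S []      = []
restrict-All S (z ∷ u) with S z in Sz
... | true  = Sz ∷ restrict-All S u
... | false = restrict-All S u

isYes-≟-refl : ∀ (v : Fin n) → isYes (v ≟ v) ≡ true
isYes-≟-refl v with v ≟ v
... | yes _  = refl
... | no v≢v = contradiction refl v≢v

≟-true⇒≡ : isYes (z ≟ v) ≡ true → z ≡ v
≟-true⇒≡ {z = z} {v} eq with z ≟ v
... | yes z≡v = z≡v

occ-++ : ∀ (v : Fin n) A B → occ v (A ++ B) ≡ occ v A + occ v B
occ-++ v A B = trans (cong length (restrict-++ (λ z → isYes (z ≟ v)) A B)) (length-++ (restrict _ A))

occ-here : ∀ (v : Fin n) u → occ v (v ∷ u) ≡ suc (occ v u)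
occ-here v u rewrite isYes-≟-refl v = refl

occ-here-pred : ∀ (v : Fin n) u {m} → occ v (v ∷ u) ≡ suc m → occ v u ≡ m
occ-here-pred v u eq = suc-injective (trans (sym (occ-here v u)) eq)

occ-here-≢0 : ∀ (v : Fin n) u → occ v (v ∷ u) ≢ 0
occ-here-≢0 v u eq = contradiction (trans (sym (occ-here v u)) eq) λ ()

occ-there : ∀ u → z ≢ v → occ v (z ∷ u) ≡ occ v u
occ-there {z = z} {v} u z≢v with z ≟ v
... | yes z≡v = contradiction z≡v z≢v
... | no _    = refl

occ-restrict-true : S v ≡ true → ∀ u → occ v (restrict S u) ≡ occ v u
occ-restrict-true {S = S} Sv u = cong length (restrict-⊆ (λ z eq → trans (cong S (≟-true⇒≡ eq)) Sv) u)

occ-restrict-false : S v ≡ false → ∀ u → occ v (restrict S u) ≡ 0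
occ-restrict-false {S = S} Sv u = cong length (restrict-disjoint (λ z eq → trans (cong S (≟-true⇒≡ eq)) Sv) u)

occ-replicate-same : ∀ (c : Fin n) h → occ c (replicate h c) ≡ h
occ-replicate-same c zero    = refl
occ-replicate-same c (suc h) = trans (occ-here c (replicate h c)) (cong suc (occ-replicate-same c h))

occ-replicate-other : c ≢ v → ∀ h → occ v (replicate h c) ≡ 0
occ-replicate-other c≢v zero    = refl
occ-replicate-other {c = c} c≢v (suc h) = trans (occ-there (replicate h c) c≢v) (occ-replicate-other c≢v h)

∈⇒occ-pos : v ∈ u → 0 < occ v u
∈⇒occ-pos {v = v} (here {xs = u} refl) rewrite occ-here v u = z<s
∈⇒occ-pos {v = v} (there {x = z} v∈u) with z ≟ v
... | yes _ = z<s
... | no _  = ∈⇒occ-pos v∈u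

occ-pos⇒∈ : ∀ u → 0 < occ v u → v ∈ u
occ-pos⇒∈ {v = v} (z ∷ u) pos with z ≟ v
... | yes refl = here refl
... | no _     = there (occ-pos⇒∈ u pos)

Alternating : Fin n → Fin n → Word n → Set
Alternating x y R = ∃[ m ] (R ≡ altWord x y m ⊎ R ≡ altWord y x m)

length-altWord : ∀ (x y : Fin n) m → length (altWord x y m) ≡ m
length-altWord x y zero    = refl
length-altWord x y (suc m) = cong suc (length-altWord y x m)

altWord-++⁻ˡ : ∀ A B m → A ++ B ≡ altWord x y m → ∃[ l ] A ≡ altWord x y l
altWord-++⁻ˡ []      B m       eq = 0 , refl
altWord-++⁻ˡ (a ∷ A) B (suc m) eq with altWord-++⁻ˡ A B m (∷-injectiveʳ eq)
... | l , A≡ = suc l , cong₂ _∷_ (∷-injectiveˡ eq) A≡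

altWord-++⁻ʳ : ∀ A B m → A ++ B ≡ altWord x y m → Alternating x y B
altWord-++⁻ʳ []      B m       eq = m , inj₁ eq
altWord-++⁻ʳ (a ∷ A) B (suc m) eq with altWord-++⁻ʳ A B m (∷-injectiveʳ eq)
... | l , inj₁ B≡ = l , inj₂ B≡
... | l , inj₂ B≡ = l , inj₁ B≡

Alternating-swap : Alternating x y R → Alternating y x R
Alternating-swap (m , inj₁ eq) = m , inj₂ eq
Alternating-swap (m , inj₂ eq) = m , inj₁ eq

Alternating-++⁻ˡ : ∀ A B → Alternating x y (A ++ B) → Alternating x y A
Alternating-++⁻ˡ A B (m , inj₁ eq) = map₂ inj₁ (altWord-++⁻ˡ A B m eq)
Alternating-++⁻ˡ A B (m , inj₂ eq) = map₂ inj₂ (altWord-++⁻ˡ A B m eq)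

Alternating-++⁻ʳ : ∀ A B → Alternating x y (A ++ B) → Alternating x y B
Alternating-++⁻ʳ A B (m , inj₁ eq) = altWord-++⁻ʳ A B m eq
Alternating-++⁻ʳ A B (m , inj₂ eq) = Alternating-swap (altWord-++⁻ʳ A B m eq)

Alternating-infix : ∀ A B C → Alternating x y (A ++ B ++ C) → Alternating x y B
Alternating-infix A B C = Alternating-++⁻ˡ B C ∘ Alternating-++⁻ʳ A (B ++ C)

occ-∷∷ˡ : x ≢ y → ∀ r → occ x (x ∷ y ∷ r) ≡ suc (occ x r)
occ-∷∷ˡ {x = x} {y} x≢y r = trans (occ-here x (y ∷ r)) (cong suc (occ-there {z = y} r (x≢y ∘ sym)))

occ-∷∷ʳ : x ≢ y → ∀ r → occ y (x ∷ y ∷ r) ≡ suc (occ y r)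
occ-∷∷ʳ {x = x} {y} x≢y r = trans (occ-there {z = x} (y ∷ r) x≢y) (occ-here y r)

Balanced : Fin n → Fin n → Word n → Set
Balanced x y R = occ x R ≡ occ y R

balanced-∷∷ : x ≢ y → ∀ r → Balanced x y (x ∷ y ∷ r) → Balanced x y r
balanced-∷∷ x≢y r bal = suc-injective (trans (sym (occ-∷∷ˡ x≢y r)) (trans bal (occ-∷∷ʳ x≢y r)))

altWord-++-∷-balanced : x ≢ y → ∀ l Z m → altWord x y l ++ x ∷ Z ≡ altWord x y m →
                        Balanced x y (altWord x y l)
altWord-++-∷-balanced x≢y zero       Z m             eq = refl
altWord-++-∷-balanced x≢y (suc zero) Z (suc (suc m)) eq = contradiction (∷-injectiveˡ (∷-injectiveʳ eq)) x≢y
altWord-++-∷-balanced {x = x} {y} x≢y (suc (suc l)) Z (suc (suc m)) eq =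
  trans (occ-∷∷ˡ x≢y r) (trans (cong suc (altWord-++-∷-balanced x≢y l Z m (∷-injectiveʳ (∷-injectiveʳ eq))))
                               (sym (occ-∷∷ʳ x≢y r)))
  where r = altWord x y l

altWord-balanced-++ : x ≢ y → ∀ l m → Balanced x y (altWord x y l) →
                      altWord x y l ++ altWord x y m ≡ altWord x y (l + m)
altWord-balanced-++ x≢y zero m bal = refl
altWord-balanced-++ {x = x} x≢y (suc zero) m bal = ⊥-elim (occ-here-≢0 x [] (trans bal (occ-there [] x≢y)))
altWord-balanced-++ {x = x} {y} x≢y (suc (suc l)) m bal =
  cong (λ r → x ∷ y ∷ r) (altWord-balanced-++ x≢y l m (balanced-∷∷ x≢y (altWord x y l) bal))

Alternating-square⁺ : x ≢ y → Balanced x y R → Alternating x y R → Alternating x y (R ++ R)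
Alternating-square⁺ x≢y bal (m , inj₁ refl) = m + m , inj₁ (altWord-balanced-++ x≢y m m bal)
Alternating-square⁺ x≢y bal (m , inj₂ refl) = m + m , inj₂ (altWord-balanced-++ (x≢y ∘ sym) m m (sym bal))

square-altWord-balanced : x ≢ y → R ≢ [] → ∀ m → R ++ R ≡ altWord x y m → Balanced x y R
square-altWord-balanced {x = x} {y} {R} x≢y R≢[] m eq with altWord-++⁻ˡ R R m eq
... | zero  , refl = contradiction refl R≢[]
... | suc l , refl = altWord-++-∷-balanced x≢y (suc l) (altWord y x l) m eq

Alternating-square⁻ : x ≢ y → R ≢ [] → Alternating x y (R ++ R) → Balanced x y R
Alternating-square⁻ x≢y R≢[] (m , inj₁ eq) = square-altWord-balanced x≢y R≢[] m eq
Alternating-square⁻ x≢y R≢[] (m , inj₂ eq) = sym (square-altWord-balanced (x≢y ∘ sym) R≢[] m eq)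

pairSet-x : ∀ (x y : Fin n) → pairSet x y x ≡ true
pairSet-x x y = cong (_∨ isYes (x ≟ y)) (isYes-≟-refl x)

pairSet-y : ∀ (x y : Fin n) → pairSet x y y ≡ true
pairSet-y x y = trans (∨-comm (isYes (y ≟ x)) _) (pairSet-x y x)

pairSet-true⁻ : pairSet x y z ≡ true → z ≡ x ⊎ z ≡ y
pairSet-true⁻ {x = x} {y} {z} eq with z ≟ x | z ≟ y
... | yes z≡x | _       = inj₁ z≡x
... | no _    | yes z≡y = inj₂ z≡y

pairSet-⊆ᵇ : S x ≡ true → S y ≡ true → pairSet x y ⊆ᵇ S
pairSet-⊆ᵇ {x = x} {y = y} Sx Sy z eq with pairSet-true⁻ {x = x} {y} {z} eq
... | inj₁ refl = Sx
... | inj₂ refl = Sy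

Alternate-sym : ∀ (w : Word n) → Alternate w x y → Alternate w y x
Alternate-sym {x = x} {y} w =
  subst (Alternating y x) (restrict-cong (λ z → ∨-comm (isYes (z ≟ x)) _) w) ∘ Alternating-swap

alternating? : ∀ (x y : Fin n) R → Dec (Alternating x y R)
alternating? x y R with ≡-dec _≟_ R (altWord x y (length R)) | ≡-dec _≟_ R (altWord y x (length R))
... | yes eq | _      = yes (_ , inj₁ eq)
... | no _   | yes eq = yes (_ , inj₂ eq)
... | no ¬xy | no ¬yx = no λ { (m , inj₁ eq) → ¬xy (exact-length eq) ; (m , inj₂ eq) → ¬yx (exact-length eq) }
  where
  exact-length : ∀ {s t : Fin _} {m} → R ≡ altWord s t m → R ≡ altWord s t (length R)
  exact-length {s = s} {t} {m} refl = cong (altWord s t) (sym (length-altWord s t m))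

alternate? : ∀ (w : Word n) x y → Dec (Alternate w x y)
alternate? w x y = alternating? x y (restrict (pairSet x y) w)

OverPair : Fin n → Fin n → Word n → Set
OverPair x y = All (λ z → z ≡ x ⊎ z ≡ y)

restrict-pairSet-OverPair : ∀ (x y : Fin n) u → OverPair x y (restrict (pairSet x y) u)
restrict-pairSet-OverPair x y u = All.map pairSet-true⁻ (restrict-All (pairSet x y) u)

OverPair-absent : OverPair x y R → occ x R ≡ 0 → occ y R ≡ 0 → R ≡ []
OverPair-absent []                             _  _  = refl
OverPair-absent {R = x ∷ R} (inj₁ refl ∷ _) x∉ _  = ⊥-elim (occ-here-≢0 x R x∉)
OverPair-absent {R = y ∷ R} (inj₂ refl ∷ _) _  y∉ = ⊥-elim (occ-here-≢0 y R y∉)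

OverPair-single : x ≢ y → OverPair x y R → occ x R ≡ 0 → occ y R ≡ 1 → R ≡ y ∷ []
OverPair-single {R = x ∷ R} x≢y (inj₁ refl ∷ _) x∉ _ = ⊥-elim (occ-here-≢0 x R x∉)
OverPair-single {R = y ∷ R} x≢y (inj₂ refl ∷ over) x∉ y₁ =
  cong (y ∷_) (OverPair-absent over (trans (sym (occ-there R (x≢y ∘ sym))) x∉) (occ-here-pred y R y₁))

OverPair-once : x ≢ y → OverPair x y R → occ x R ≡ 1 → occ y R ≡ 1 → Alternating x y R
OverPair-once {R = x ∷ R} x≢y (inj₁ refl ∷ over) x₁ y₁ =
  2 , inj₁ (cong (x ∷_) (OverPair-single x≢y over (occ-here-pred x R x₁) (trans (sym (occ-there R x≢y)) y₁)))
OverPair-once {R = y ∷ R} x≢y (inj₂ refl ∷ over) x₁ y₁ =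
  2 , inj₂ (cong (y ∷_) (OverPair-single (x≢y ∘ sym) (All.map swap over)
                                        (occ-here-pred y R y₁) (trans (sym (occ-there R (x≢y ∘ sym))) x₁)))

occ-restrict-pairSet-x : ∀ (x y : Fin n) u → occ x (restrict (pairSet x y) u) ≡ occ x u
occ-restrict-pairSet-x x y = occ-restrict-true (pairSet-x x y)

occ-restrict-pairSet-y : ∀ (x y : Fin n) u → occ y (restrict (pairSet x y) u) ≡ occ y u
occ-restrict-pairSet-y x y = occ-restrict-true (pairSet-y x y)

Alternate-once : ∀ u → x ≢ y → occ x u ≡ 1 → occ y u ≡ 1 → Alternate u x y
Alternate-once {x = x} {y} u x≢y x₁ y₁ =
  OverPair-once x≢y (restrict-pairSet-OverPair x y u)
    (trans (occ-restrict-pairSet-x x y u) x₁) (trans (occ-restrict-pairSet-y x y u) y₁)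

restrict-pairSet-absent : ∀ u → occ x u ≡ 0 → occ y u ≡ 0 → restrict (pairSet x y) u ≡ []
restrict-pairSet-absent {x = x} {y = y} u x∉ y∉ =
  OverPair-absent (restrict-pairSet-OverPair x y u)
    (trans (occ-restrict-pairSet-x x y u) x∉) (trans (occ-restrict-pairSet-y x y u) y∉)

half-≤ : ∀ {a b} → a + a ≤ suc (b + b) → a ≤ b
half-≤ {a} {b} 2a≤2b+1 with a ≤? b
... | yes a≤b = a≤b
... | no  a≰b = contradiction (≤-trans (+-mono-≤ (≰⇒> a≰b) (≰⇒> a≰b)) 2a≤2b+1)
                              (λ le → <-irrefl refl (subst (_≤ b + b) (+-suc b b) (≤-pred le)))

parity : ∀ k → ∃[ h ] (k ≡ h + h ⊎ k ≡ suc (h + h))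
parity zero    = 0 , inj₁ refl
parity (suc k) with parity k
... | h , inj₁ refl = h , inj₂ refl
... | h , inj₂ refl = suc h , inj₁ (cong suc (sym (+-suc h h)))

+-square-split : ∀ a p b → a + (p + (p + b)) ≡ (p + p) + (a + b)
+-square-split = solve-∀

≤⌈/2⌉+⌈/2⌉ : ∀ m → m ≤ ⌈ m /2⌉ + ⌈ m /2⌉
≤⌈/2⌉+⌈/2⌉ m = ≤-trans (≤-reflexive (sym (⌊n/2⌋+⌈n/2⌉≡n m))) (+-monoˡ-≤ _ (⌊n/2⌋≤⌈n/2⌉ m))

+-tight : ∀ {a b c d} → a ≤ c → b ≤ d → c + d ≤ a + b → a ≡ c × b ≡ d
+-tight {a} {b} {c} {d} a≤c b≤d c+d≤a+b =
  ≤-antisym a≤c (+-cancelʳ-≤ d c a (≤-trans c+d≤a+b (+-monoʳ-≤ a b≤d))) ,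
  ≤-antisym b≤d (+-cancelˡ-≤ c d b (≤-trans c+d≤a+b (+-monoˡ-≤ b a≤c)))

sum-const : ∀ n k → sum {n} (λ _ → k) ≡ k * n
sum-const zero    k = sym (*-zeroʳ k)
sum-const (suc n) k = trans (cong (k +_) (sum-const n k)) (sym (*-suc k n))

sum-≤ : ∀ {n} (f : Fin n → ℕ) {h} → (∀ i → f i ≤ h) → sum f ≤ h * n
sum-≤ {zero}  f f≤h = z≤n
sum-≤ {suc n} f {h} f≤h =
  subst (sum f ≤_) (sym (*-suc h n)) (+-mono-≤ (f≤h fzero) (sum-≤ (f ∘ fsuc) (f≤h ∘ fsuc)))

sum-≤-tight : ∀ {n} (f : Fin n → ℕ) {h} → (∀ i → f i ≤ h) → h * n ≤ sum f → ∀ i → f i ≡ h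
sum-≤-tight {suc n} f {h} f≤h tight
  with +-tight (f≤h fzero) (sum-≤ (f ∘ fsuc) (f≤h ∘ fsuc)) (subst (_≤ sum f) (*-suc h n) tight)
... | head≡ , tail≡ = λ
  { fzero    → head≡
  ; (fsuc i) → sum-≤-tight (f ∘ fsuc) (f≤h ∘ fsuc) (≤-reflexive (sym tail≡)) i }

sum-≤-one-short : ∀ {n} (f : Fin n → ℕ) {h} → (∀ i → f i ≤ h) → h * n ≤ suc (sum f) →
  (∀ i → f i ≡ h) ⊎ ∃[ c ] (suc (f c) ≡ h × ∀ i → i ≢ c → f i ≡ h)
sum-≤-one-short {zero} f f≤h almost = inj₁ λ ()
sum-≤-one-short {suc m} f {h} f≤h almost with all? (λ i → f i ℕ.≟ h)
... | yes all≡ = inj₁ all≡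
... | no ¬all≡ with ¬∀⟶∃¬ (suc m) _ (λ i → f i ℕ.≟ h) ¬all≡
... | c , fc≢h = inj₂ (c , proj₁ tight , others≡h)
  where
  rest : Fin m → ℕ
  rest = removeAt f c
  tight : suc (f c) ≡ h × sum rest ≡ h * m
  tight = +-tight (≤∧≢⇒< (f≤h c) fc≢h) (sum-≤ rest (f≤h ∘ punchIn c))
                  (subst₂ (λ a b → a ≤ suc b) (*-suc h m) (sum-remove f) almost)
  others≡h : ∀ i → i ≢ c → f i ≡ h
  others≡h i i≢c = subst (λ j → f j ≡ h) (punchIn-punchOut (i≢c ∘ sym))
    (sum-≤-tight rest (f≤h ∘ punchIn c) (≤-reflexive (sym (proj₂ tight))) (punchOut (i≢c ∘ sym)))

length≡sum-occ : ∀ (u : Word n) → length u ≡ sum (λ v → occ v u)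
length≡sum-occ {n} [] = sym (sum-const n 0)
length≡sum-occ {suc m} (z ∷ u) = begin
  suc (length u)                                         ≡⟨ cong suc (length≡sum-occ u) ⟩
  suc (sum (λ v → occ v u))                              ≡⟨ cong suc (sum-remove {i = z} (λ v → occ v u)) ⟩
  suc (occ z u + sum (removeAt (λ v → occ v u) z))       ≡⟨ cong₂ _+_ (sym (occ-here z u)) (sum-cong-≗ others) ⟩
  occ z (z ∷ u) + sum (removeAt (λ v → occ v (z ∷ u)) z) ≡⟨ sym (sum-remove (λ v → occ v (z ∷ u))) ⟩
  sum (λ v → occ v (z ∷ u))                              ∎
  where
  open ≡-Reasoning
  others : ∀ i → occ (punchIn z i) u ≡ occ (punchIn z i) (z ∷ u)
  others i = sym (occ-there u (punchInᵢ≢i z i ∘ sym))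

-- Circle graphs that are complete away from one vertex

CompleteAwayFrom : SimpleGraph n → Fin n → Set
CompleteAwayFrom G v = ∀ x y → x ≢ v → y ≢ v → x ≢ y → SimpleGraph.Adj G x y

ChordsIntersect-sym : ∀ c d → ChordsIntersect c d → ChordsIntersect d c
ChordsIntersect-sym _ _ (inj₁ a≡c)                               = inj₁ (sym a≡c)
ChordsIntersect-sym _ _ (inj₂ (inj₁ a≡d))                        = inj₂ (inj₂ (inj₁ (sym a≡d)))
ChordsIntersect-sym _ _ (inj₂ (inj₂ (inj₁ b≡c)))                 = inj₂ (inj₁ (sym b≡c))
ChordsIntersect-sym _ _ (inj₂ (inj₂ (inj₂ (inj₁ b≡d))))          = inj₂ (inj₂ (inj₂ (inj₁ (sym b≡d))))
ChordsIntersect-sym _ _ (inj₂ (inj₂ (inj₂ (inj₂ (inj₁ cross))))) = inj₂ (inj₂ (inj₂ (inj₂ (inj₂ cross))))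
ChordsIntersect-sym _ _ (inj₂ (inj₂ (inj₂ (inj₂ (inj₂ cross))))) = inj₂ (inj₂ (inj₂ (inj₂ (inj₁ cross))))

module ChordModel {m} (G : SimpleGraph (suc m)) (adj? : Decidable (SimpleGraph.Adj G))
                  (v : Fin (suc m)) (complete : CompleteAwayFrom G v) where
  open SimpleGraph G using (Adj) renaming (sym to Adj-sym)

  -- v gets the hub chord (1, m+3); every other vertex a spoke at the point 0 whose other end lies
  -- inside the hub (crossing it) if it is adjacent to v, and beyond the hub's end otherwise.
  hub : Chord
  hub = 1 , 3 + m

  spoke : ∀ {A : Set} → Dec A → ℕ → Chord
  spoke (yes _) i = 0 , 2 + i
  spoke (no _)  i = 0 , 4 + (m + i)

  chord : Fin (suc m) → Chord
  chord x with x ≟ v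
  ... | yes _ = hub
  ... | no _  = spoke (adj? v x) (toℕ x)

  spoke-start : ∀ {A : Set} (d : Dec A) i → proj₁ (spoke d i) ≡ 0
  spoke-start (yes _) i = refl
  spoke-start (no _)  i = refl

  spoke-valid : ∀ {A : Set} (d : Dec A) i → ValidChord (spoke d i)
  spoke-valid (yes _) i = z<s
  spoke-valid (no _)  i = z<s

  chord-valid : ∀ x → ValidChord (chord x)
  chord-valid x with x ≟ v
  ... | yes _ = s<s (s≤s z≤n)
  ... | no _  = spoke-valid (adj? v x) (toℕ x)

  inner<outer : ∀ {i} j → i < suc m → 2 + i < 4 + (m + j)
  inner<outer j (s≤s i≤m) = s<s (s<s (≤-trans (s≤s i≤m) (≤-trans (m≤m+n (suc m) j) (n≤1+n _))))

  spoke-injective : ∀ {A B : Set} (d : Dec A) (e : Dec B) {i j} →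
                    i < suc m → j < suc m → spoke d i ≡ spoke e j → i ≡ j
  spoke-injective (yes _) (yes _) _ _ eq = suc-injective (suc-injective (cong proj₂ eq))
  spoke-injective (no _)  (no _)  _ _ eq =
    +-cancelˡ-≡ m _ _ (suc-injective (suc-injective (suc-injective (suc-injective (cong proj₂ eq)))))
  spoke-injective (yes _) (no _)  {j = j} i< _ eq = contradiction (cong proj₂ eq) (<⇒≢ (inner<outer j i<))
  spoke-injective (no _)  (yes _) {i} _ j< eq = contradiction (sym (cong proj₂ eq)) (<⇒≢ (inner<outer i j<))

  hub-spoke : ∀ {A : Set} (d : Dec A) i → i < suc m → A ⇔ ChordsIntersect hub (spoke d i)
  hub-spoke (yes a) i i≤m = mk⇔ (λ _ → inj₂ (inj₂ (inj₂ (inj₂ (inj₂ crossing))))) (λ _ → a)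
    where
    crossing : 0 < 1 × 1 < 2 + i × 2 + i < 3 + m
    crossing = z<s , s≤s (s≤s z≤n) , s<s (s<s i≤m)
  hub-spoke (no ¬a) i _ = mk⇔ (λ a → contradiction a ¬a) (⊥-elim ∘ nested)
    where
    nested : ¬ ChordsIntersect hub (0 , 4 + (m + i))
    nested (inj₂ (inj₂ (inj₂ (inj₁ eq)))) = m≢1+m+n m (suc-injective (suc-injective (suc-injective eq)))
    nested (inj₂ (inj₂ (inj₂ (inj₂ (inj₂ (_ , _ , 5+m+i≤3+m)))))) =
      1+n≰n (≤-trans (s≤s (s≤s (s≤s (s≤s (m≤m+n m i))))) (≤-trans (n≤1+n _) 5+m+i≤3+m))

  chord-injective : ∀ x y → x ≢ y → chord x ≢ chord y
  chord-injective x y x≢y with x ≟ v | y ≟ v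
  ... | yes refl | yes refl = contradiction refl x≢y
  ... | yes refl | no _     = λ eq → 1+n≢n (trans (cong proj₁ eq) (spoke-start (adj? x y) (toℕ y)))
  ... | no _     | yes refl = λ eq → 1+n≢n (trans (cong proj₁ (sym eq)) (spoke-start (adj? y x) (toℕ x)))
  ... | no _     | no _     = x≢y ∘ toℕ-injective ∘ spoke-injective (adj? v x) (adj? v y) (toℕ<n x) (toℕ<n y)

  adjacent⇔intersect : ∀ x y → x ≢ y → Adj x y ⇔ ChordsIntersect (chord x) (chord y)
  adjacent⇔intersect x y x≢y with x ≟ v | y ≟ v
  ... | yes refl | yes refl = contradiction refl x≢y
  ... | yes refl | no _     = hub-spoke (adj? x y) (toℕ y) (toℕ<n y)
  ... | no _     | yes refl = mk⇔ (ChordsIntersect-sym _ _ ∘ Equivalence.to hub⇔ ∘ Adj-sym)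
                                  (Adj-sym ∘ Equivalence.from hub⇔ ∘ ChordsIntersect-sym _ _)
    where hub⇔ = hub-spoke (adj? y x) (toℕ x) (toℕ<n x)
  ... | no x≢v   | no y≢v   =
    mk⇔ (λ _ → inj₁ (trans (spoke-start (adj? v x) (toℕ x)) (sym (spoke-start (adj? v y) (toℕ y)))))
        (λ _ → complete x y x≢v y≢v x≢y)

  circle : CircleGraph G
  circle = chord , chord-valid , chord-injective , adjacent⇔intersect

  clique : ContainsClique G m
  clique = punchIn v , punchIn-injective v ,
           λ i j i≢j → complete _ _ (punchInᵢ≢i v i) (punchInᵢ≢i v j) (i≢j ∘ punchIn-injective v i j)

completeAwayFrom⇒excluded : (G : SimpleGraph n) → Decidable (SimpleGraph.Adj G) → CompleteAwayFrom G v →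
                            CircleGraph G × ContainsClique G (n ∸ 1)
completeAwayFrom⇒excluded {suc m} {v} G adj? complete = circle , clique
  where open ChordModel G adj? v complete

small⇒excluded : (G : SimpleGraph n) → Decidable (SimpleGraph.Adj G) → n ≤ 2 →
                 CircleGraph G × ContainsClique G (n ∸ 1)
small⇒excluded {0} G adj? _ = ((λ ()) , (λ ()) , (λ ()) , (λ ())) , ((λ ()) , (λ ()) , (λ ()))
small⇒excluded {1} G adj? _ = completeAwayFrom⇒excluded G adj? λ { fzero _ 0≢0 _ _ → contradiction refl 0≢0 }
small⇒excluded {2} G adj? _ = completeAwayFrom⇒excluded G adj? λ
  { fzero _ 0≢0 _ _                    → contradiction refl 0≢0
  ; (fsuc fzero) fzero _ 0≢0 _         → contradiction refl 0≢0
  ; (fsuc fzero) (fsuc fzero) _ _ 1≢1 → contradiction refl 1≢1 }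
small⇒excluded {suc (suc (suc _))} G adj? (s≤s (s≤s ()))

-- Erasing an isolated letter

erase : Fin n → Word n → Word n
erase c = restrict (λ z → not (isYes (z ≟ c)))

kept-by-erase : x ≢ c → not (isYes (x ≟ c)) ≡ true
kept-by-erase {x = x} {c} x≢c with x ≟ c
... | yes x≡c = contradiction x≡c x≢c
... | no _    = refl

occ-erase-same : ∀ (c : Fin n) u → occ c (erase c u) ≡ 0
occ-erase-same c = occ-restrict-false (cong not (isYes-≟-refl c))

occ-erase-other : x ≢ c → ∀ u → occ x (erase c u) ≡ occ x u
occ-erase-other x≢c = occ-restrict-true (kept-by-erase x≢c)

¬Alternating-repeat : x ≢ y → ∀ A C → ¬ Alternating x y (A ++ x ∷ x ∷ C)
¬Alternating-repeat {x = x} x≢y A C alt =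
  occ-here-≢0 x [] (trans (Alternating-square⁻ {R = x ∷ []} x≢y (λ ()) (Alternating-infix A (x ∷ x ∷ []) C alt))
                          (occ-there [] x≢y))

replicate-2+ : ∀ {h} {c : Fin n} → 2 ≤ h → replicate h c ≡ c ∷ c ∷ replicate (h ∸ 2) c
replicate-2+ (s≤s (s≤s _)) = refl

module AppendIsolated (G : SimpleGraph n) (c : Fin n) (isolated : ∀ y → y ≢ c → ¬ SimpleGraph.Adj G c y)
                      (h : ℕ) (2≤h : 2 ≤ h) (u : Word n) where
  open SimpleGraph G using (Adj) renaming (sym to Adj-sym)

  moved : Word n
  moved = erase c u ++ replicate h c

  occ-moved-same : occ c moved ≡ h
  occ-moved-same = trans (occ-++ c (erase c u) _) (cong₂ _+_ (occ-erase-same c u) (occ-replicate-same c h))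

  occ-moved-other : x ≢ c → occ x moved ≡ occ x u
  occ-moved-other {x = x} x≢c = begin
    occ x moved                               ≡⟨ occ-++ x (erase c u) _ ⟩
    occ x (erase c u) + occ x (replicate h c) ≡⟨ cong (_+ _) (occ-erase-other x≢c u) ⟩
    occ x u + occ x (replicate h c)           ≡⟨ cong (_ +_) (occ-replicate-other (x≢c ∘ sym) h) ⟩
    occ x u + 0                               ≡⟨ +-identityʳ _ ⟩
    occ x u                                   ∎
    where open ≡-Reasoning

  restrict-moved : x ≢ c → y ≢ c → restrict (pairSet x y) moved ≡ restrict (pairSet x y) u
  restrict-moved {x = x} {y} x≢c y≢c = begin
    restrict P moved                                     ≡⟨ restrict-++ P (erase c u) _ ⟩
    restrict P (erase c u) ++ restrict P (replicate h c) ≡⟨ cong₂ _++_ kept dropped ⟩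
    restrict P u ++ []                                   ≡⟨ ++-identityʳ _ ⟩
    restrict P u                                         ∎
    where
    open ≡-Reasoning
    P = pairSet x y
    kept : restrict P (erase c u) ≡ restrict P u
    kept = restrict-⊆ (pairSet-⊆ᵇ (kept-by-erase x≢c) (kept-by-erase y≢c)) u
    dropped : restrict P (replicate h c) ≡ []
    dropped = restrict-pairSet-absent (replicate h c) (occ-replicate-other (x≢c ∘ sym) h)
                                                      (occ-replicate-other (y≢c ∘ sym) h)

  ¬Alternate-moved : y ≢ c → ¬ Alternate moved c y
  ¬Alternate-moved {y = y} y≢c =
    ¬Alternating-repeat (y≢c ∘ sym) (restrict (pairSet c y) (erase c u)) (replicate (h ∸ 2) c) ∘
    subst (Alternating c y) (trans (restrict-++ (pairSet c y) (erase c u) _)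
                                   (cong (restrict (pairSet c y) (erase c u) ++_)
                                         (trans (restrict-replicate (pairSet-x c y) h) (replicate-2+ 2≤h))))

  represents-moved : (∀ x → x ≢ c → x ∈ u) → (∀ x y → x ≢ c → y ≢ c → x ≢ y → Alternate u x y ⇔ Adj x y) →
                     Represents G moved
  represents-moved occurs represents = occurs-moved , alternate⇔adjacent
    where
    occurs-moved : ∀ x → x ∈ moved
    occurs-moved x with x ≟ c
    ... | yes refl = occ-pos⇒∈ moved (subst (0 <_) (sym occ-moved-same) (≤-trans (s≤s z≤n) 2≤h))
    ... | no x≢c   = occ-pos⇒∈ moved (subst (0 <_) (sym (occ-moved-other x≢c)) (∈⇒occ-pos (occurs x x≢c)))

    alternate⇔adjacent : ∀ x y → x ≢ y → Alternate moved x y ⇔ Adj x y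
    alternate⇔adjacent x y x≢y with x ≟ c | y ≟ c
    ... | yes refl | yes refl = contradiction refl x≢y
    ... | yes refl | no y≢c   = mk⇔ (⊥-elim ∘ ¬Alternate-moved y≢c) (⊥-elim ∘ isolated y y≢c)
    ... | no x≢c   | yes refl = mk⇔ (⊥-elim ∘ ¬Alternate-moved x≢c ∘ Alternate-sym moved)
                                    (⊥-elim ∘ isolated x x≢c ∘ Adj-sym)
    ... | no x≢c   | no y≢c   = subst (λ R → Alternating x y R ⇔ Adj x y) (sym (restrict-moved x≢c y≢c))
                                      (represents x y x≢c y≢c x≢y)

-- Squares in restrictions of a uniform representant

module SquareInRestriction (G : SimpleGraph n) {k} (w : Word n)
                           (uniform : Uniform k w) (represents : Represents G w)
                           (S : Fin n → Bool) (a X b : Word n) (split : restrict S w ≡ a ++ X ++ X ++ b) where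
  open SimpleGraph G using (Adj)

  occ-split : ∀ x → occ x (restrict S w) ≡ (occ x X + occ x X) + (occ x a + occ x b)
  occ-split x = begin
    occ x (restrict S w)                      ≡⟨ cong (occ x) split ⟩
    occ x (a ++ X ++ X ++ b)                  ≡⟨ occ-++ x a _ ⟩
    occ x a + occ x (X ++ X ++ b)             ≡⟨ cong (occ x a +_) (occ-++ x X _) ⟩
    occ x a + (occ x X + occ x (X ++ b))      ≡⟨ cong (λ o → occ x a + (occ x X + o)) (occ-++ x X b) ⟩
    occ x a + (occ x X + (occ x X + occ x b)) ≡⟨ +-square-split (occ x a) (occ x X) (occ x b) ⟩
    (occ x X + occ x X) + (occ x a + occ x b) ∎
    where open ≡-Reasoning

  occ-restrict-≤ : ∀ x → occ x (restrict S w) ≤ k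
  occ-restrict-≤ x with S x in Sx
  ... | true  = ≤-reflexive (trans (occ-restrict-true Sx w) (uniform x))
  ... | false = ≤-trans (≤-reflexive (occ-restrict-false Sx w)) z≤n

  twice-occ-≤ : ∀ x → occ x X + occ x X ≤ k
  twice-occ-≤ x = ≤-trans (≤-trans (m≤m+n _ _) (≤-reflexive (sym (occ-split x)))) (occ-restrict-≤ x)

  occurs⇒selected : 0 < occ x X → S x ≡ true
  occurs⇒selected {x = x} occurs with S x in Sx
  ... | true  = refl
  ... | false = ⊥-elim (<⇒≢ (≤-trans occurs (≤-trans (m≤m+n (occ x X) _) (m≤m+n _ _)))
                            (sym (trans (sym (occ-split x)) (occ-restrict-false Sx w))))

  restrict-pairSet-split : S x ≡ true → S y ≡ true → let P = pairSet x y in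
    restrict P w ≡ restrict P a ++ (restrict P X ++ restrict P X) ++ restrict P b
  restrict-pairSet-split {x = x} {y} Sx Sy = begin
    restrict P w                                       ≡⟨ restrict-⊆ (pairSet-⊆ᵇ Sx Sy) w ⟨
    restrict P (restrict S w)                          ≡⟨ cong (restrict P) split ⟩
    restrict P (a ++ X ++ X ++ b)                      ≡⟨ restrict-++ P a _ ⟩
    restrict P a ++ restrict P (X ++ X ++ b)           ≡⟨ cong (restrict P a ++_) (restrict-++ P X _) ⟩
    restrict P a ++ restrict P X ++ restrict P (X ++ b)
      ≡⟨ cong (λ B → restrict P a ++ restrict P X ++ B) (restrict-++ P X b) ⟩
    restrict P a ++ restrict P X ++ restrict P X ++ restrict P b
      ≡⟨ cong (restrict P a ++_) (++-assoc (restrict P X) _ _) ⟨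
    restrict P a ++ (restrict P X ++ restrict P X) ++ restrict P b ∎
    where
    open ≡-Reasoning
    P = pairSet x y

  alternate⇒balanced : x ≢ y → 0 < occ x X → 0 < occ y X → Alternate w x y → Balanced x y X
  alternate⇒balanced {x = x} {y} x≢y x∈X y∈X alt = begin
    occ x X    ≡⟨ occ-restrict-pairSet-x x y X ⟨
    occ x Xˣʸ  ≡⟨ Alternating-square⁻ x≢y Xˣʸ≢[] (Alternating-infix (restrict P a) _ (restrict P b) alt′) ⟩
    occ y Xˣʸ  ≡⟨ occ-restrict-pairSet-y x y X ⟩
    occ y X    ∎
    where
    open ≡-Reasoning
    P = pairSet x y
    Xˣʸ = restrict P X
    alt′ : Alternating x y (restrict P a ++ (Xˣʸ ++ Xˣʸ) ++ restrict P b)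
    alt′ = subst (Alternating x y) (restrict-pairSet-split (occurs⇒selected x∈X) (occurs⇒selected y∈X)) alt
    Xˣʸ≢[] : Xˣʸ ≢ []
    Xˣʸ≢[] Xˣʸ≡[] = <⇒≢ y∈X (trans (sym (cong (occ y) Xˣʸ≡[])) (occ-restrict-pairSet-y x y X))

  -- A letter occurring k/2 times in X occurs nowhere else in w_S, so for two such letters w_{x,y}
  -- is the square of X_{x,y}.
  module Saturated (h : ℕ) (k≡h+h : k ≡ h + h) (0<h : 0 < h) where

    positive : occ x X ≡ h → 0 < occ x X
    positive x-sat = subst (0 <_) (sym x-sat) 0<h

    absent-outside : occ x X ≡ h → occ x a ≡ 0 × occ x b ≡ 0
    absent-outside {x = x} x-sat = m+n≡0⇒m≡0 _ a+b≡0 , m+n≡0⇒n≡0 (occ x a) a+b≡0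
      where
      a+b≡0 : occ x a + occ x b ≡ 0
      a+b≡0 = +-cancelˡ-≡ (h + h) _ _ (begin
        (h + h) + (occ x a + occ x b)             ≡⟨ cong (λ o → (o + o) + _) x-sat ⟨
        (occ x X + occ x X) + (occ x a + occ x b) ≡⟨ occ-split x ⟨
        occ x (restrict S w)                      ≡⟨ occ-restrict-true (occurs⇒selected (positive x-sat)) w ⟩
        occ x w                                   ≡⟨ trans (uniform x) k≡h+h ⟩
        h + h                                     ≡⟨ +-identityʳ _ ⟨
        (h + h) + 0                               ∎)
        where open ≡-Reasoning

    alternate⇔ : x ≢ y → occ x X ≡ h → occ y X ≡ h → Alternate w x y ⇔ Alternate X x y
    alternate⇔ {x = x} {y} x≢y x-sat y-sat =
      mk⇔ (Alternating-++⁻ˡ Xˣʸ Xˣʸ ∘ subst (Alternating x y) square)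
          (subst (Alternating x y) (sym square) ∘ Alternating-square⁺ x≢y balanced)
      where
      P = pairSet x y
      Xˣʸ = restrict P X
      square : restrict P w ≡ Xˣʸ ++ Xˣʸ
      square = begin
        restrict P w
          ≡⟨ restrict-pairSet-split (occurs⇒selected (positive x-sat)) (occurs⇒selected (positive y-sat)) ⟩
        restrict P a ++ (Xˣʸ ++ Xˣʸ) ++ restrict P b ≡⟨ cong₂ (λ A B → A ++ (Xˣʸ ++ Xˣʸ) ++ B)
              (restrict-pairSet-absent a (proj₁ (absent-outside x-sat)) (proj₁ (absent-outside y-sat)))
              (restrict-pairSet-absent b (proj₂ (absent-outside x-sat)) (proj₂ (absent-outside y-sat))) ⟩
        (Xˣʸ ++ Xˣʸ) ++ []                           ≡⟨ ++-identityʳ _ ⟩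
        Xˣʸ ++ Xˣʸ                                   ∎
        where open ≡-Reasoning
      balanced : Balanced x y Xˣʸ
      balanced = begin
        occ x Xˣʸ ≡⟨ occ-restrict-pairSet-x x y X ⟩
        occ x X   ≡⟨ trans x-sat (sym y-sat) ⟩
        occ y X   ≡⟨ occ-restrict-pairSet-y x y X ⟨
        occ y Xˣʸ ∎
        where open ≡-Reasoning

    represents-X : (∀ x → occ x X ≡ h) → Represents G X
    represents-X saturated =
      (λ x → occ-pos⇒∈ X (positive (saturated x))) ,
      (λ x y x≢y → ⇔-trans (⇔-sym (alternate⇔ x≢y (saturated x) (saturated y))) (proj₂ represents x y x≢y))

    represents-away-from : (∀ x → x ≢ c → occ x X ≡ h) →
                           ∀ x y → x ≢ c → y ≢ c → x ≢ y → Alternate X x y ⇔ Adj x y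
    represents-away-from saturated x y x≢c y≢c x≢y =
      ⇔-trans (⇔-sym (alternate⇔ x≢y (saturated x x≢c) (saturated y y≢c))) (proj₂ represents x y x≢y)

    short⇒isolated : (∀ x → x ≢ c → occ x X ≡ h) → suc (occ c X) ≡ h → 0 < occ c X → ∀ y → y ≢ c → ¬ Adj c y
    short⇒isolated {c = c} saturated short c∈X y y≢c adj = 1+n≢n (trans short (sym c≡y))
      where
      c≡y : occ c X ≡ h
      c≡y = trans (alternate⇒balanced (y≢c ∘ sym) c∈X (positive (saturated y y≢c))
                                      (Equivalence.from (proj₂ represents c y (y≢c ∘ sym)) adj))
                  (saturated y y≢c)

    once⇒complete : h ≡ 1 → (∀ x → x ≢ c → occ x X ≡ h) → CompleteAwayFrom G c
    once⇒complete h≡1 saturated x y x≢c y≢c x≢y =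
      Equivalence.to (represents-away-from saturated x y x≢c y≢c x≢y)
                     (Alternate-once X x≢y (trans (saturated x x≢c) h≡1) (trans (saturated y y≢c) h≡1))

  module LongSquare (long : ⌈ k * n /2⌉ ∸ 1 ≤ length X) where

    kn≤ : k * n ≤ suc (length X) + suc (length X)
    kn≤ = ≤-trans (≤⌈/2⌉+⌈/2⌉ (k * n)) (+-mono-≤ half≤ half≤)
      where
      half≤ : ⌈ k * n /2⌉ ≤ suc (length X)
      half≤ = ≤-trans (m≤n+m∸n _ 1) (s≤s long)

    occ-≤-half : ∀ {h} → k ≤ suc (h + h) → ∀ x → occ x X ≤ h
    occ-≤-half k≤ x = half-≤ (≤-trans (twice-occ-≤ x) k≤)

    odd⇒small : ∀ h → k ≡ suc (h + h) → n ≤ 2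
    odd⇒small h k≡ = +-cancelʳ-≤ (h * n + h * n) n 2 (begin
      n + (h * n + h * n)   ≡⟨ cong (n +_) (*-distribʳ-+ n h h) ⟨
      suc (h + h) * n       ≡⟨ cong (_* n) k≡ ⟨
      k * n                 ≤⟨ kn≤ ⟩
      suc L + suc L         ≡⟨ cong suc (+-suc L L) ⟩
      2 + (L + L)           ≤⟨ +-monoʳ-≤ 2 (+-mono-≤ L≤ L≤) ⟩
      2 + (h * n + h * n)   ∎)
      where
      open ≤-Reasoning
      L = length X
      L≤ : L ≤ h * n
      L≤ = subst (_≤ h * n) (sym (length≡sum-occ X)) (sum-≤ _ (occ-≤-half {h} (≤-reflexive k≡)))

    even⇒one-short : ∀ h → k ≡ h + h →
                     (∀ x → occ x X ≡ h) ⊎ ∃[ c ] (suc (occ c X) ≡ h × ∀ x → x ≢ c → occ x X ≡ h)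
    even⇒one-short h k≡ =
      sum-≤-one-short (λ x → occ x X) (occ-≤-half {h} (≤-trans (≤-reflexive k≡) (n≤1+n _))) hn≤
      where
      2hn≤ : h * n + h * n ≤ suc (length X) + suc (length X)
      2hn≤ = ≤-trans (≤-reflexive (trans (sym (*-distribʳ-+ n h h)) (cong (_* n) (sym k≡)))) kn≤
      hn≤ : h * n ≤ suc (sum (λ x → occ x X))
      hn≤ = subst (λ L → h * n ≤ suc L) (length≡sum-occ X) (half-≤ (≤-trans 2hn≤ (n≤1+n _)))

adjacent? : ∀ (G : SimpleGraph n) w → Represents G w → Decidable (SimpleGraph.Adj G)
adjacent? G w represents x y with x ≟ y
... | yes refl = no (SimpleGraph.irrefl G)
... | no x≢y   = map-Dec (proj₂ represents x y x≢y) (alternate? w x y)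

length-uniform : ∀ {k} (w : Word n) → Uniform k w → length w ≡ k * n
length-uniform {n} {k} w uniform = trans (length≡sum-occ w) (trans (sum-cong-≗ uniform) (sum-const n k))

uniform-positive : ∀ {k} w → Uniform k w → (∀ v → v ∈ w) → Fin n → 0 < k
uniform-positive w uniform occurs v = subst (0 <_) (uniform v) (∈⇒occ-pos (occurs v))

module MinimalRepresentant (G : SimpleGraph n) {k} (w : Word n)
         (uniform : Uniform k w) (represents : Represents G w)
         (minimal : ∀ k′ → k′ < k → ∀ w′ → Uniform k′ w′ → ¬ Represents G w′)
         (notExcluded : ¬ (CircleGraph G × ContainsClique G (n ∸ 1))) where

  module _ (S : Fin n → Bool) (a X b : Word n) (split : restrict S w ≡ a ++ X ++ X ++ b) where
    open SquareInRestriction G w uniform represents S a X b split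

    half<k : ∀ h → k ≡ suc h + suc h → suc h < k
    half<k h k≡ = subst (suc h <_) (sym k≡) (m<m+n (suc h) z<s)

    one-short⇒⊥ : ∀ h c → k ≡ suc h + suc h → occ c X ≡ h → (∀ x → x ≢ c → occ x X ≡ suc h) → ⊥
    one-short⇒⊥ zero    c k≡ c∉X saturated =
      notExcluded (completeAwayFrom⇒excluded G (adjacent? G w represents) (once⇒complete refl saturated))
      where open Saturated 1 k≡ z<s
    one-short⇒⊥ (suc h) c k≡ c-count saturated =
      minimal (2 + h) (half<k (suc h) k≡) moved uniform-moved
              (represents-moved occurs (represents-away-from saturated))
      where
      open Saturated (2 + h) k≡ z<s
      open AppendIsolated G c (short⇒isolated saturated (cong suc c-count) (subst (0 <_) (sym c-count) z<s))
                          (2 + h) (s≤s (s≤s z≤n)) X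
      occurs : ∀ x → x ≢ c → x ∈ X
      occurs x x≢c = occ-pos⇒∈ X (positive (saturated x x≢c))
      uniform-moved : Uniform (2 + h) moved
      uniform-moved x with x ≟ c
      ... | yes refl = occ-moved-same
      ... | no x≢c   = trans (occ-moved-other x≢c) (saturated x x≢c)

    long⇒⊥ : 3 ≤ n → ⌈ k * n /2⌉ ∸ 1 ≤ length X → ⊥
    long⇒⊥ 3≤n long with parity k
    ... | h     , inj₂ k≡ = <⇒≱ 3≤n (LongSquare.odd⇒small long h k≡)
    ... | zero  , inj₁ k≡ = <⇒≢ (uniform-positive w uniform (proj₁ represents) (fromℕ< 3≤n)) (sym k≡)
    ... | suc h , inj₁ k≡ with LongSquare.even⇒one-short long (suc h) k≡
    ...   | inj₁ saturated =
            minimal (suc h) (half<k h k≡) X saturated (Saturated.represents-X (suc h) k≡ z<s saturated)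
    ...   | inj₂ (c , short , saturated) = one-short⇒⊥ h c k≡ (suc-injective short) saturated

  complete-square-free : 3 ≤ n → ¬ ContainsCompleteSquare (⌈ k * n /2⌉ ∸ 1) w
  complete-square-free 3≤n (S , a , X , b , split , long , _) = long⇒⊥ S a X b split 3≤n long

mainTheorem11 : ∀ (n : ℕ) (G : SimpleGraph n) (k : ℕ) →
    WordRepresentable G → RepresentationNumber G k →
    ¬ (CircleGraph G × ContainsClique G (n ∸ 1)) →
    CSFUniformWordRepresentable G (⌈ k * n /2⌉ ∸ 1)
mainTheorem11 n G k _ ((w , uniform , represents) , minimal) notExcluded with 3 ≤? n
... | no  n≱3 = contradiction (small⇒excluded G (adjacent? G w represents) (≤-pred (≰⇒> n≱3))) notExcluded
... | yes 3≤n = w , (k , uniform) , represents , complete-square-free 3≤n , 1≤p , p≤⌈|w|/2⌉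
  where
  open MinimalRepresentant G w uniform represents minimal notExcluded
  n≤kn : n ≤ k * n
  n≤kn = ≤-trans (≤-reflexive (sym (*-identityˡ n)))
                 (*-monoˡ-≤ n (uniform-positive w uniform (proj₁ represents) (fromℕ< 3≤n)))
  1≤p : 1 ≤ ⌈ k * n /2⌉ ∸ 1
  1≤p = ∸-monoˡ-≤ 1 (⌈n/2⌉-mono (≤-trans 3≤n n≤kn))
  p≤⌈|w|/2⌉ : ⌈ k * n /2⌉ ∸ 1 ≤ ⌈ length w /2⌉
  p≤⌈|w|/2⌉ = subst (λ L → ⌈ k * n /2⌉ ∸ 1 ≤ ⌈ L /2⌉) (sym (length-uniform w uniform)) (m∸n≤m _ 1)
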